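{- For any prime $p$ and any positive integer $r$, $$2R_1(p)\equiv -\sum_{i=1}^{r}p^iR_{i+1}(p)\pmod{p^{r+1}}.$$
   Context: For a prime $p$ and positive integer $n$, $R_n(p)=\sum_{k=1}^{p-1}\frac{1}{k^n}$. For rational numbers $a,b$ whose denominators are not divisible by $p$, $a\equiv b\pmod{p^m}$ means $a-b=p^m c$ with $c$ rational with denominator not divisible by $p$. -}

module Defs where

open import Data.Nat as ℕ using (ℕ; zero; suc; _∸_)
open import Data.Nat.Divisibility using (_∣_)
open import Data.Nat.Properties using (m^n≢0)
open import Data.Integer as ℤ using (ℤ; +_)
open import Data.Rational as ℚ using (ℚ; 0ℚ; _+_; _-_; _*_; ↧ₙ_)
open import Data.Product using (Σ; _×_)
open import Relation.Binary.PropositionalEquality using (_≡_)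
open import Relation.Nullary using (¬_)

inv-pow : (j n : ℕ) → ℚ
inv-pow j n = (+ 1) ℚ./ (suc j ℕ.^ n)
  where instance _ = m^n≢0 (suc j) n

sumTo : ℕ → (ℕ → ℚ) → ℚ
sumTo zero    f = 0ℚ
sumTo (suc m) f = sumTo m f + f m

-- R_n(p) = Σ_{k=1}^{p-1} 1/k^n   (k = j+1, j = 0 .. p-2)
R : ℕ → ℕ → ℚ
R n p = sumTo (p ∸ 1) (λ j → inv-pow j n)

-- rational p-adic congruence: a ≡ b (mod p^m) iff a - b = p^m c with
-- c rational whose (reduced) denominator is not divisible by p
infix 4 _≡_[modℚ_^_]
_≡_[modℚ_^_] : ℚ → ℚ → ℕ → ℕ → Set
a ≡ b [modℚ p ^ m ] =
  Σ ℚ (λ c → (a - b ≡ ((+ (p ℕ.^ m)) ℚ./ 1) * c) × ¬ (p ∣ (↧ₙ c)))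

-- If k + k′ = p then 1/k + 1/k′ = p · (1/k) · (1/k′). Writing x = 1/k and
-- y = 1/k′, this relation telescopes to y + Σ_{i<n} pⁱ x^{i+1} = pⁿ xⁿ y.
-- Summing over k = 1 … p-1, where k′ = p - k runs over the same range so
-- that Σ y = R₁(p), gives
--   R₁(p) + Σ_{i≤r} pⁱ R_{i+1}(p) = p^{r+1} Σ_k k^{-(r+1)} (p-k)^{-1},
-- and the last sum has no factor p in its denominator.
module Submission where

open import Defs
open import Data.Nat using (ℕ; suc)
open import Data.Nat.Primality using (Prime)
open import Data.Integer using (+_)
open import Data.Rational using (ℚ; -_; _*_; _/_)

open import Data.Nat as ℕ using (zero; _∸_; _<_; NonZero; s≤s; z<s)
import Data.Nat.Properties as ℕ
open import Data.Nat.Divisibility using (_∣_; _∤_; divides; ∣-trans; >⇒∤)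
open import Data.Nat.Coprimality as Coprime using (coprime-divisor)
open import Data.Nat.Primality using (euclidsLemma; prime⇒nonTrivial; ¬prime[0])
open import Data.Integer as ℤ using (ℤ)
import Data.Integer.Properties as ℤ
open import Data.Rational using (_+_; _-_; 0ℚ; 1ℚ; mkℚ; ↧ₙ_; toℚᵘ; fromℚᵘ; +-*-rawSemiring)
open import Data.Rational.Properties
  using (+-comm; +-assoc; *-identityˡ; *-identityʳ; *-zeroʳ; *-assoc;
         *-distribˡ-+; toℚᵘ-injective; toℚᵘ-fromℚᵘ; toℚᵘ-cong; toℚᵘ-homo-+; toℚᵘ-homo-*;
         fromℚᵘ-cong)
import Data.Rational.Unnormalised as ℚᵘ
import Data.Rational.Unnormalised.Properties as ℚᵘ
open import Data.Rational.Solver using (module +-*-Solver)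
open +-*-Solver using (solve; _:=_; _:+_; _:*_; :-_; _:-_; con)
open import Algebra.Definitions.RawSemiring +-*-rawSemiring using (_^_)
open import Data.Product using (Σ; _,_; _×_)
open import Data.Sum using (inj₁; inj₂)
open import Relation.Nullary using (contradiction)
open import Relation.Binary.PropositionalEquality using (_≡_; refl; sym; trans; cong; cong₂; module ≡-Reasoning)
open ≡-Reasoning

1/suc_ : ℕ → ℚ
1/suc j = (+ 1) / suc j

fromℚᵘ-homo-+ : ∀ a b → fromℚᵘ (a ℚᵘ.+ b) ≡ fromℚᵘ a + fromℚᵘ b
fromℚᵘ-homo-+ a b = toℚᵘ-injective (ℚᵘ.≃-trans (toℚᵘ-fromℚᵘ (a ℚᵘ.+ b))
  (ℚᵘ.≃-trans (ℚᵘ.+-cong (ℚᵘ.≃-sym (toℚᵘ-fromℚᵘ a)) (ℚᵘ.≃-sym (toℚᵘ-fromℚᵘ b)))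
    (ℚᵘ.≃-sym (toℚᵘ-homo-+ (fromℚᵘ a) (fromℚᵘ b)))))

fromℚᵘ-homo-* : ∀ a b → fromℚᵘ (a ℚᵘ.* b) ≡ fromℚᵘ a * fromℚᵘ b
fromℚᵘ-homo-* a b = toℚᵘ-injective (ℚᵘ.≃-trans (toℚᵘ-fromℚᵘ (a ℚᵘ.* b))
  (ℚᵘ.≃-trans (ℚᵘ.*-cong (ℚᵘ.≃-sym (toℚᵘ-fromℚᵘ a)) (ℚᵘ.≃-sym (toℚᵘ-fromℚᵘ b)))
    (ℚᵘ.≃-sym (toℚᵘ-homo-* (fromℚᵘ a) (fromℚᵘ b)))))

ℤ/1-homo-+ : ∀ m n → (m ℤ.+ n) / 1 ≡ m / 1 + n / 1
ℤ/1-homo-+ m n = trans (cong (_/ 1) (sym (cong₂ ℤ._+_ (ℤ.*-identityʳ m) (ℤ.*-identityʳ n))))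
  (fromℚᵘ-homo-+ (ℚᵘ.mkℚᵘ m 0) (ℚᵘ.mkℚᵘ n 0))

ℤ/1-homo-* : ∀ m n → (m ℤ.* n) / 1 ≡ m / 1 * (n / 1)
ℤ/1-homo-* m n = fromℚᵘ-homo-* (ℚᵘ.mkℚᵘ m 0) (ℚᵘ.mkℚᵘ n 0)

/1-homo-+ : ∀ a b → (+ (a ℕ.+ b)) / 1 ≡ (+ a) / 1 + (+ b) / 1
/1-homo-+ a b = trans (cong (_/ 1) (ℤ.pos-+ a b)) (ℤ/1-homo-+ (+ a) (+ b))

/1-homo-* : ∀ a b → (+ (a ℕ.* b)) / 1 ≡ (+ a) / 1 * ((+ b) / 1)
/1-homo-* a b = trans (cong (_/ 1) (ℤ.pos-* a b)) (ℤ/1-homo-* (+ a) (+ b))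

/1-homo-^ : ∀ a n → (+ (a ℕ.^ n)) / 1 ≡ ((+ a) / 1) ^ n
/1-homo-^ a zero    = refl
/1-homo-^ a (suc n) = trans (/1-homo-* a (a ℕ.^ n)) (cong ((+ a) / 1 *_) (/1-homo-^ a n))

1/-homo-* : ∀ a b .{{_ : NonZero a}} .{{_ : NonZero b}} →
            _/_ (+ 1) (a ℕ.* b) {{ℕ.m*n≢0 a b}} ≡ (+ 1) / a * ((+ 1) / b)
1/-homo-* (suc a) (suc b) = fromℚᵘ-homo-* (ℚᵘ.mkℚᵘ (+ 1) a) (ℚᵘ.mkℚᵘ (+ 1) b)

/1-*-1/ : ∀ a .{{_ : NonZero a}} → (+ a) / 1 * ((+ 1) / a) ≡ 1ℚ
/1-*-1/ (suc a) = trans (sym (fromℚᵘ-homo-* (ℚᵘ.mkℚᵘ (+ suc a) 0) (ℚᵘ.mkℚᵘ (+ 1) a)))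
  (fromℚᵘ-cong {ℚᵘ.mkℚᵘ (+ suc a) 0 ℚᵘ.* ℚᵘ.mkℚᵘ (+ 1) a} {ℚᵘ.mkℚᵘ (+ 1) 0}
    (ℚᵘ.*≡* (begin
    + suc a ℤ.* + 1 ℤ.* + 1     ≡⟨ ℤ.*-identityʳ _ ⟩
    + suc a ℤ.* + 1             ≡⟨ ℤ.*-identityʳ (+ suc a) ⟩
    + suc a                     ≡⟨ cong (λ k → + suc k) (sym (ℕ.+-identityʳ a)) ⟩
    + suc (a ℕ.+ 0)             ≡⟨ sym (ℤ.*-identityˡ _) ⟩
    + 1 ℤ.* + suc (a ℕ.+ 0)     ∎)))

inv-pow-^ : ∀ j n → inv-pow j n ≡ 1/suc j ^ n
inv-pow-^ j zero    = refl
inv-pow-^ j (suc n) = trans (1/-homo-* (suc j) (suc j ℕ.^ n) {{_}} {{ℕ.m^n≢0 (suc j) n}})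
  (cong (1/suc j *_) (inv-pow-^ j n))

1/suc-+ : ∀ j k → 1/suc j + 1/suc k ≡ (+ (suc j ℕ.+ suc k)) / 1 * 1/suc j * 1/suc k
1/suc-+ j k = sym (begin
  (+ (suc j ℕ.+ suc k)) / 1 * x * y  ≡⟨ cong (λ a → a * x * y) (/1-homo-+ (suc j) (suc k)) ⟩
  (J + K) * x * y
    ≡⟨ solve 4 (λ J K x y → (J :+ K) :* x :* y := (J :* x) :* y :+ (K :* y) :* x) refl J K x y ⟩
  (J * x) * y + (K * y) * x          ≡⟨ cong₂ (λ a b → a * y + b * x) (/1-*-1/ (suc j)) (/1-*-1/ (suc k)) ⟩
  1ℚ * y + 1ℚ * x                    ≡⟨ solve 2 (λ x y → con 1ℚ :* y :+ con 1ℚ :* x := x :+ y) refl x y ⟩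
  x + y                              ∎)
  where
  x y J K : ℚ
  x = 1/suc j
  y = 1/suc k
  J = (+ suc j) / 1
  K = (+ suc k) / 1

sumTo-cong : ∀ m {f g : ℕ → ℚ} → (∀ {j} → j < m → f j ≡ g j) → sumTo m f ≡ sumTo m g
sumTo-cong zero    f≗g = refl
sumTo-cong (suc m) f≗g = cong₂ _+_ (sumTo-cong m (λ j<m → f≗g (ℕ.m<n⇒m<1+n j<m))) (f≗g (ℕ.n<1+n m))

sumTo-zero : ∀ m → sumTo m (λ _ → 0ℚ) ≡ 0ℚ
sumTo-zero zero    = refl
sumTo-zero (suc m) = cong (_+ 0ℚ) (sumTo-zero m)

sumTo-+ : ∀ m f g → sumTo m (λ j → f j + g j) ≡ sumTo m f + sumTo m g
sumTo-+ zero    f g = refl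
sumTo-+ (suc m) f g = trans (cong (_+ (f m + g m)) (sumTo-+ m f g))
  (solve 4 (λ a b c d → (a :+ b) :+ (c :+ d) := (a :+ c) :+ (b :+ d)) refl (sumTo m f) (sumTo m g) (f m) (g m))

sumTo-*ˡ : ∀ m c f → sumTo m (λ j → c * f j) ≡ c * sumTo m f
sumTo-*ˡ zero    c f = sym (*-zeroʳ c)
sumTo-*ˡ (suc m) c f = trans (cong (_+ c * f m) (sumTo-*ˡ m c f)) (sym (*-distribˡ-+ c _ _))

sumTo-sucˡ : ∀ m f → sumTo (suc m) f ≡ f 0 + sumTo m (λ j → f (suc j))
sumTo-sucˡ zero    f = +-comm 0ℚ (f 0)
sumTo-sucˡ (suc m) f = trans (cong (_+ f (suc m)) (sumTo-sucˡ m f)) (+-assoc (f 0) _ _)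

sumTo-comm : ∀ m n (f : ℕ → ℕ → ℚ) →
             sumTo m (λ j → sumTo n (f j)) ≡ sumTo n (λ i → sumTo m (λ j → f j i))
sumTo-comm zero    n f = sym (sumTo-zero n)
sumTo-comm (suc m) n f = trans (cong (_+ sumTo n (f m)) (sumTo-comm m n f))
  (sym (sumTo-+ n (λ i → sumTo m (λ j → f j i)) (f m)))

sumTo-reverse : ∀ m f → sumTo m f ≡ sumTo m (λ j → f (m ∸ suc j))
sumTo-reverse zero    f = refl
sumTo-reverse (suc m) f = begin
  sumTo m f + f m                                 ≡⟨ cong (_+ f m) (sumTo-reverse m f) ⟩
  sumTo m (λ j → f (m ∸ suc j)) + f m             ≡⟨ +-comm _ (f m) ⟩
  f m + sumTo m (λ j → f (m ∸ suc j))             ≡⟨ sym (sumTo-sucˡ m (λ j → f (m ∸ j))) ⟩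
  sumTo (suc m) (λ j → f (suc m ∸ suc j))         ∎

telescope : ∀ {a x y : ℚ} → x + y ≡ a * x * y →
            ∀ r → y + sumTo r (λ i → a ^ i * x ^ suc i) ≡ a ^ r * x ^ r * y
telescope {y = y} _ zero = solve 1 (λ y → y :+ con 0ℚ := con 1ℚ :* con 1ℚ :* y) refl y
telescope {a} {x} {y} x+y≡axy (suc r) = begin
  y + (sumTo r term + A * (x * X))    ≡⟨ sym (+-assoc y _ _) ⟩
  (y + sumTo r term) + A * (x * X)    ≡⟨ cong (_+ A * (x * X)) (telescope x+y≡axy r) ⟩
  A * X * y + A * (x * X)
    ≡⟨ solve 4 (λ A X x y → A :* X :* y :+ A :* (x :* X) := A :* X :* (x :+ y)) refl A X x y ⟩
  A * X * (x + y)                     ≡⟨ cong (A * X *_) x+y≡axy ⟩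
  A * X * (a * x * y)
    ≡⟨ solve 5 (λ A X a x y → A :* X :* (a :* x :* y) := a :* A :* (x :* X) :* y) refl A X a x y ⟩
  a * A * (x * X) * y                 ∎
  where
  term : ℕ → ℚ
  term i = a ^ i * x ^ suc i
  A X : ℚ
  A = a ^ r
  X = x ^ r

telescope-sumTo : ∀ {a} m (x y : ℕ → ℚ) → (∀ {j} → j < m → x j + y j ≡ a * x j * y j) → ∀ r →
                  sumTo m y + sumTo r (λ i → a ^ i * sumTo m (λ j → x j ^ suc i))
                    ≡ a ^ r * sumTo m (λ j → x j ^ r * y j)
telescope-sumTo {a} m x y x+y≡axy r = begin
  sumTo m y + sumTo r (λ i → a ^ i * sumTo m (λ j → x j ^ suc i))
    ≡⟨ cong (_+_ (sumTo m y)) (sumTo-cong r (λ {i} _ → sym (sumTo-*ˡ m (a ^ i) (λ j → x j ^ suc i)))) ⟩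
  sumTo m y + sumTo r (λ i → sumTo m (λ j → a ^ i * x j ^ suc i))
    ≡⟨ cong (_+_ (sumTo m y)) (sym (sumTo-comm m r (λ j i → a ^ i * x j ^ suc i))) ⟩
  sumTo m y + sumTo m (λ j → sumTo r (λ i → a ^ i * x j ^ suc i))
    ≡⟨ sym (sumTo-+ m y _) ⟩
  sumTo m (λ j → y j + sumTo r (λ i → a ^ i * x j ^ suc i))
    ≡⟨ sumTo-cong m (λ j<m → trans (telescope (x+y≡axy j<m) r) (*-assoc (a ^ r) _ _)) ⟩
  sumTo m (λ j → a ^ r * (x j ^ r * y j))
    ≡⟨ sumTo-*ˡ m (a ^ r) _ ⟩
  a ^ r * sumTo m (λ j → x j ^ r * y j) ∎

-- Σ_{k=1}^{p-1} k^{-r} (p-k)^{-1} for p = m + 1, indexed by j = k - 1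
reflectedSum : ℕ → ℕ → ℚ
reflectedSum m r = sumTo m (λ j → 1/suc j ^ r * 1/suc (m ∸ suc j))

R-as-sum-of-powers : ∀ n p → R n p ≡ sumTo (p ∸ 1) (λ j → 1/suc j ^ n)
R-as-sum-of-powers n p = sumTo-cong (p ∸ 1) (λ {j} _ → inv-pow-^ j n)

suc+suc[m∸suc]≡suc : ∀ {m j} → j < m → suc j ℕ.+ suc (m ∸ suc j) ≡ suc m
suc+suc[m∸suc]≡suc {m} {j} j<m = trans (ℕ.+-suc (suc j) (m ∸ suc j)) (cong suc (ℕ.m+[n∸m]≡n j<m))

R₁-+-power-series : ∀ m r →
  R 1 (suc m) + sumTo r (λ i → ((+ suc m) / 1) ^ i * R (suc i) (suc m))
    ≡ ((+ suc m) / 1) ^ r * reflectedSum m r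
R₁-+-power-series m r = begin
  R 1 (suc m) + sumTo r (λ i → P ^ i * R (suc i) (suc m))
    ≡⟨ cong₂ _+_ R₁≡Σy
         (sumTo-cong r (λ {i} _ → cong (P ^ i *_) (R-as-sum-of-powers (suc i) (suc m)))) ⟩
  sumTo m y + sumTo r (λ i → P ^ i * sumTo m (λ j → 1/suc j ^ suc i))
    ≡⟨ telescope-sumTo m 1/suc_ y reciprocal-pair r ⟩
  P ^ r * reflectedSum m r ∎
  where
  P : ℚ
  P = (+ suc m) / 1
  y : ℕ → ℚ
  y j = 1/suc (m ∸ suc j)
  R₁≡Σy : R 1 (suc m) ≡ sumTo m y
  R₁≡Σy = trans (sumTo-reverse m (λ j → inv-pow j 1))
    (sumTo-cong m (λ {j} _ → trans (inv-pow-^ (m ∸ suc j) 1) (*-identityʳ _)))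
  reciprocal-pair : ∀ {j} → j < m → 1/suc j + y j ≡ P * 1/suc j * y j
  reciprocal-pair {j} j<m = trans (1/suc-+ j (m ∸ suc j))
    (cong (λ n → (+ n) / 1 * 1/suc j * y j) (suc+suc[m∸suc]≡suc j<m))

PIntegral : ℕ → ℚ → Set
PIntegral p q = Σ ℕ λ d → p ∤ d × Σ ℤ λ n → (+ d) / 1 * q ≡ n / 1

/1-*-≡⇒≃ : ∀ {d} q n → (+ d) / 1 * q ≡ n / 1 →
           ℚᵘ.mkℚᵘ (+ d) 0 ℚᵘ.* toℚᵘ q ℚᵘ.≃ ℚᵘ.mkℚᵘ n 0
/1-*-≡⇒≃ {d} q n dq≡n =
  ℚᵘ.≃-trans (ℚᵘ.*-cong (ℚᵘ.≃-sym (toℚᵘ-fromℚᵘ (ℚᵘ.mkℚᵘ (+ d) 0))) ℚᵘ.≃-refl)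
    (ℚᵘ.≃-trans (ℚᵘ.≃-sym (toℚᵘ-homo-* ((+ d) / 1) q))
      (ℚᵘ.≃-trans (toℚᵘ-cong dq≡n) (toℚᵘ-fromℚᵘ (ℚᵘ.mkℚᵘ n 0))))

↧ₙ-∣ : ∀ {d} q n → (+ d) / 1 * q ≡ n / 1 → ↧ₙ q ∣ d
↧ₙ-∣ {d} q@(mkℚ num den coprime) n dq≡n with ℚᵘ.*≡* eq ← /1-*-≡⇒≃ {d} q n dq≡n
  = coprime-divisor (Coprime.sym (Coprime.recompute coprime)) (divides ℤ.∣ n ∣ (begin
      ℤ.∣ num ∣ ℕ.* d                        ≡⟨ ℕ.*-comm ℤ.∣ num ∣ d ⟩
      d ℕ.* ℤ.∣ num ∣                        ≡⟨ sym (ℤ.abs-* (+ d) num) ⟩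
      ℤ.∣ + d ℤ.* num ∣                      ≡⟨ cong ℤ.∣_∣ (sym (ℤ.*-identityʳ (+ d ℤ.* num))) ⟩
      ℤ.∣ + d ℤ.* num ℤ.* + 1 ∣              ≡⟨ cong ℤ.∣_∣ eq ⟩
      ℤ.∣ n ℤ.* + suc (den ℕ.+ 0) ∣          ≡⟨ ℤ.abs-* n _ ⟩
      ℤ.∣ n ∣ ℕ.* suc (den ℕ.+ 0)            ≡⟨ cong (λ k → ℤ.∣ n ∣ ℕ.* suc k) (ℕ.+-identityʳ den) ⟩
      ℤ.∣ n ∣ ℕ.* suc den                    ∎))

PIntegral⇒∤↧ₙ : ∀ {p q} → PIntegral p q → p ∤ ↧ₙ q
PIntegral⇒∤↧ₙ {q = q} (d , p∤d , n , dq≡n) p∣↧q = p∤d (∣-trans p∣↧q (↧ₙ-∣ q n dq≡n))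

module _ {p : ℕ} (p-prime : Prime p) where

  private
    ∤-* : ∀ {a b} → p ∤ a → p ∤ b → p ∤ a ℕ.* b
    ∤-* {a} {b} p∤a p∤b p∣ab with euclidsLemma a b p-prime p∣ab
    ... | inj₁ p∣a = p∤a p∣a
    ... | inj₂ p∣b = p∤b p∣b

  PIntegral-/1 : ∀ n → PIntegral p (n / 1)
  PIntegral-/1 n = 1 , >⇒∤ (ℕ.nonTrivial⇒n>1 p {{prime⇒nonTrivial p-prime}}) , n , *-identityˡ (n / 1)

  PIntegral-1/ : ∀ d .{{_ : NonZero d}} → p ∤ d → PIntegral p ((+ 1) / d)
  PIntegral-1/ d p∤d = d , p∤d , + 1 , /1-*-1/ d

  PIntegral-+ : ∀ {x y} → PIntegral p x → PIntegral p y → PIntegral p (x + y)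
  PIntegral-+ {x} {y} (d , p∤d , n , dx≡n) (e , p∤e , k , ey≡k) =
    d ℕ.* e , ∤-* p∤d p∤e , + e ℤ.* n ℤ.+ + d ℤ.* k , (begin
      (+ (d ℕ.* e)) / 1 * (x + y)   ≡⟨ cong (_* (x + y)) (/1-homo-* d e) ⟩
      D * E * (x + y)
        ≡⟨ solve 4 (λ D E x y → D :* E :* (x :+ y) := E :* (D :* x) :+ D :* (E :* y)) refl D E x y ⟩
      E * (D * x) + D * (E * y)     ≡⟨ cong₂ (λ u v → E * u + D * v) dx≡n ey≡k ⟩
      E * (n / 1) + D * (k / 1)     ≡⟨ sym (cong₂ _+_ (ℤ/1-homo-* (+ e) n) (ℤ/1-homo-* (+ d) k)) ⟩
      (+ e ℤ.* n) / 1 + (+ d ℤ.* k) / 1 ≡⟨ sym (ℤ/1-homo-+ (+ e ℤ.* n) (+ d ℤ.* k)) ⟩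
      (+ e ℤ.* n ℤ.+ + d ℤ.* k) / 1 ∎)
    where
    D E : ℚ
    D = (+ d) / 1
    E = (+ e) / 1

  PIntegral-* : ∀ {x y} → PIntegral p x → PIntegral p y → PIntegral p (x * y)
  PIntegral-* {x} {y} (d , p∤d , n , dx≡n) (e , p∤e , k , ey≡k) =
    d ℕ.* e , ∤-* p∤d p∤e , n ℤ.* k , (begin
      (+ (d ℕ.* e)) / 1 * (x * y)   ≡⟨ cong (_* (x * y)) (/1-homo-* d e) ⟩
      D * E * (x * y)
        ≡⟨ solve 4 (λ D E x y → D :* E :* (x :* y) := (D :* x) :* (E :* y)) refl D E x y ⟩
      (D * x) * (E * y)             ≡⟨ cong₂ _*_ dx≡n ey≡k ⟩
      (n / 1) * (k / 1)             ≡⟨ sym (ℤ/1-homo-* n k) ⟩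
      (n ℤ.* k) / 1                 ∎)
    where
    D E : ℚ
    D = (+ d) / 1
    E = (+ e) / 1

  PIntegral-^ : ∀ {x} → PIntegral p x → ∀ n → PIntegral p (x ^ n)
  PIntegral-^ x-int zero    = PIntegral-/1 (+ 1)
  PIntegral-^ x-int (suc n) = PIntegral-* x-int (PIntegral-^ x-int n)

  PIntegral-sumTo : ∀ m {f} → (∀ {j} → j < m → PIntegral p (f j)) → PIntegral p (sumTo m f)
  PIntegral-sumTo zero    f-int = PIntegral-/1 (+ 0)
  PIntegral-sumTo (suc m) f-int =
    PIntegral-+ (PIntegral-sumTo m (λ j<m → f-int (ℕ.m<n⇒m<1+n j<m))) (f-int (ℕ.n<1+n m))

reflectedSum-PIntegral : ∀ m r → Prime (suc m) → PIntegral (suc m) (reflectedSum m r)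
reflectedSum-PIntegral m r p-prime = PIntegral-sumTo p-prime m (λ j<m →
  PIntegral-* p-prime (PIntegral-^ p-prime (1/suc-integral (s≤s j<m)) r)
                      (1/suc-integral (s≤s (ℕ.∸-monoʳ-< z<s j<m))))
  where
  1/suc-integral : ∀ {k} → suc k < suc m → PIntegral (suc m) (1/suc k)
  1/suc-integral {k} k<m = PIntegral-1/ p-prime (suc k) (>⇒∤ k<m)

lemma2p3 : (p r : ℕ) → Prime p → 0 Data.Nat.< r →
    (((+ 2) / 1) * R 1 p) ≡ (- sumTo r (λ i → ((+ (p Data.Nat.^ suc i)) / 1) * R (suc (suc i)) p)) [modℚ p ^ suc r ]
lemma2p3 zero    r p-prime _ = contradiction p-prime ¬prime[0]
-- the congruence also holds for r = 0
lemma2p3 (suc m) r p-prime _ =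
  reflectedSum m (suc r) , difference , PIntegral⇒∤↧ₙ (reflectedSum-PIntegral m (suc r) p-prime)
  where
  p : ℕ
  p = suc m
  P R₁ Σ′ : ℚ
  P = (+ p) / 1
  R₁ = R 1 p
  Σ′ = sumTo r (λ i → ((+ (p ℕ.^ suc i)) / 1) * R (suc (suc i)) p)
  difference : ((+ 2) / 1) * R₁ - (- Σ′) ≡ (+ (p ℕ.^ suc r)) / 1 * reflectedSum m (suc r)
  difference = begin
    ((+ 2) / 1) * R₁ - (- Σ′)
      ≡⟨ solve 2 (λ a s → con ((+ 2) / 1) :* a :- (:- s) := a :+ (con 1ℚ :* a :+ s)) refl R₁ Σ′ ⟩
    R₁ + (1ℚ * R₁ + Σ′)
      ≡⟨ cong (λ s → R₁ + (1ℚ * R₁ + s))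
           (sumTo-cong r (λ {i} _ → cong (_* R (suc (suc i)) p) (/1-homo-^ p (suc i)))) ⟩
    R₁ + (1ℚ * R₁ + sumTo r (λ i → P ^ suc i * R (suc (suc i)) p))
      ≡⟨ cong (_+_ R₁) (sym (sumTo-sucˡ r (λ i → P ^ i * R (suc i) p))) ⟩
    R₁ + sumTo (suc r) (λ i → P ^ i * R (suc i) p)
      ≡⟨ R₁-+-power-series m (suc r) ⟩
    P ^ suc r * reflectedSum m (suc r)
      ≡⟨ cong (_* reflectedSum m (suc r)) (sym (/1-homo-^ p (suc r))) ⟩
    (+ (p ℕ.^ suc r)) / 1 * reflectedSum m (suc r) ∎
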